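{- Let $N\ge 847$ and for primes $p$ let $S_p=\{(x,px): x\in\mathbb{N},\ px\le N\}$. Consider the algorithm that runs through the primes $5,3,2$ in this (descending) order, and for each such $p$ runs through the pairs of $S_p$ in descending order, selecting each pair that shares no endpoint with any previously selected pair. Then the sum of the larger elements $px$ over all selected pairs $(x,px)$ is strictly greater than half of $1+2+\dots+N=N(N+1)/2$.
   Context: This is the "born-free matching with $p_{max}=5$" algorithm for the Taxman game on $\{1,\dots,N\}$; the sum of the larger elements of the selected pairs is the player's score of the corresponding play, and $1+\dots+N$ is the pot. -}

module Defs where

open import Data.Nat using (ℕ; zero; suc; _+_; _*_; _/_; _≟_)
open import Data.Nat.Properties using (_≟_)
open import Data.List using (List; []; _∷_; map; foldl; _++_)
open import Data.Nat.ListAction using (sum)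
open import Data.Product using (_×_; _,_; proj₁; proj₂)
open import Data.Bool using (Bool; true; false; _∨_; not; if_then_else_)
open import Relation.Nullary.Decidable using (⌊_⌋)

-- A pair (x , p * x); the first component is the smaller element.
Pair : Set
Pair = ℕ × ℕ

downTo1 : ℕ → List ℕ
downTo1 zero    = []
downTo1 (suc n) = suc n ∷ downTo1 n

S : (p : ℕ) → .{{_ : Data.Nat.NonZero p}} → ℕ → List Pair
S p N = map (λ x → (x , p * x)) (downTo1 (N / p))

occurs : ℕ → List Pair → Bool
occurs v []             = false
occurs v ((a , b) ∷ ps) = ⌊ v ≟ a ⌋ ∨ ⌊ v ≟ b ⌋ ∨ occurs v ps

step : List Pair → Pair → List Pair
step sel (a , b) =
  if occurs a sel ∨ occurs b sel then sel else ((a , b) ∷ sel)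

greedy : List Pair → List Pair → List Pair
greedy sel cands = foldl step sel cands

bornFree5 : ℕ → List Pair
bornFree5 N = greedy [] (S 5 N ++ S 3 N ++ S 2 N)

score : List Pair → ℕ
score ps = sum (map proj₂ ps)

pot : ℕ → ℕ
pot N = sum (downTo1 N)

-- In the pass for the prime p (with c = 25, 5, 3 for p = 5, 3, 2) the pair (x , p x) is
-- certainly selected when N < c x and x is prime to the primes of the earlier passes: every
-- pair selected before has the form (a , q a) with q a ≤ N, and either q = p and a > x, or
-- q is an earlier prime; in each case N < c x together with a > x or q ∤ x rules out a
-- shared endpoint. Hence the score is at least 5 A₅ + 3 A₃ + 2 A₂, where A_p sums these x,
-- and sieving out the multiples of 3 and 5 writes each A_p through triangular numbers
-- T ⌊N / k⌋ with k ∣ 450. The claim becomes Σ c_k T ⌊N / k⌋ < Σ c′_k T ⌊N / k⌋; replacing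
-- N by N + 450 adds to both sides expressions linear in the ⌊N / k⌋, whose own increments
-- are constants. So everything reduces to finite checks: 847 ≤ N < 1297 for the sums and
-- 0 ≤ N < 450 for the increments.

module Submission where

open import Defs
open import Data.Bool using (Bool; true; false; _∧_; _∨_; not; if_then_else_; T)
open import Data.Bool.Properties using (T-∧; T-≡)
open import Data.List using (List; []; _∷_; map; foldl; _++_)
open import Data.List.Properties using (foldl-++)
open import Data.List.Membership.Propositional using (_∈_)
open import Data.List.Relation.Unary.Any using (here; there)
open import Data.List.Relation.Unary.All as All using (All; []; _∷_)
open import Data.Nat
open import Data.Nat.Properties
open import Data.Nat.DivMod
  using (_/_; _%_; m≡m%n+[m/n]*n; m%n<n; m<n⇒m%n≡m; [m+kn]%n≡m%n; %-congˡ; /-congˡ;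
         m*n/n≡m; m/n*n≤m; /-monoˡ-≤; /-monoʳ-≤; +-distrib-/-∣ʳ; m<n⇒m/n≡0; 0/n≡0;
         m*[n/m]≡n; m/n/o≡m/[n*o]; n/1≡n)
open import Data.Nat.Divisibility using (_∣_; _∣?_; divides; n∣m⇒m%n≡0; ∣-trans; n∣m*n)
open import Data.Nat.Coprimality using (Coprime; coprime?; coprime-divisor)
open import Data.Nat.Tactic.RingSolver using (solve-∀; solve)
open import Algebra.Properties.CommutativeSemigroup +-commutativeSemigroup using (x∙yz≈y∙xz; interchange)
open import Data.Product using (_×_; _,_; proj₁; proj₂; ∃-syntax)
open import Data.Sum using (_⊎_; inj₁; inj₂)
open import Data.Empty using (⊥)
open import Function.Base using (_∘_; _∋_)
open import Function.Bundles using (Equivalence)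
open import Relation.Nullary using (¬_; yes; no; contradiction)
open import Relation.Nullary.Decidable using (⌊_⌋; toWitness)
open import Relation.Nullary.Reflects using (ofʸ; ofⁿ)
open import Relation.Binary.PropositionalEquality

sumTo : (ℕ → ℕ) → ℕ → ℕ
sumTo f zero    = 0
sumTo f (suc n) = f (suc n) + sumTo f n

tri : ℕ → ℕ
tri = sumTo (λ x → x)

pot≡tri : ∀ N → pot N ≡ tri N
pot≡tri zero    = refl
pot≡tri (suc N) = cong (suc N +_) (pot≡tri N)

tri-+ : ∀ m n → tri (m + n) ≡ tri m + (m * n + tri n)
tri-+ zero    n = refl
tri-+ (suc m) n rewrite tri-+ m n = lemma m n (tri m) (tri n)
  where
  lemma : ∀ m n a b → suc (m + n) + (a + (m * n + b)) ≡ suc m + a + (n + m * n + b)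
  lemma = solve-∀

sumTo-cong : ∀ {f g} → (∀ x → f x ≡ g x) → ∀ n → sumTo f n ≡ sumTo g n
sumTo-cong f≗g zero    = refl
sumTo-cong f≗g (suc n) = cong₂ _+_ (f≗g (suc n)) (sumTo-cong f≗g n)

sumTo-*ˡ : ∀ k f n → sumTo (λ x → k * f x) n ≡ k * sumTo f n
sumTo-*ˡ k f zero    = sym (*-zeroʳ k)
sumTo-*ˡ k f (suc n) =
  trans (cong (k * f (suc n) +_) (sumTo-*ˡ k f n)) (sym (*-distribˡ-+ k (f (suc n)) (sumTo f n)))

≤-/⇒*-≤ : ∀ {x m} d .{{_ : NonZero d}} → x ≤ m / d → d * x ≤ m
≤-/⇒*-≤ {x} {m} d x≤m/d = begin
  d * x       ≤⟨ *-monoʳ-≤ d x≤m/d ⟩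
  d * (m / d) ≡⟨ *-comm d (m / d) ⟩
  m / d * d   ≤⟨ m/n*n≤m m d ⟩
  m           ∎
  where open ≤-Reasoning

*-≤⇒≤-/ : ∀ {x m} d .{{_ : NonZero d}} → d * x ≤ m → x ≤ m / d
*-≤⇒≤-/ {x} {m} d dx≤m = begin
  x           ≡⟨ m*n/n≡m x d ⟨
  x * d / d   ≤⟨ /-monoˡ-≤ d (≤-trans (≤-reflexive (*-comm x d)) dx≤m) ⟩
  m / d       ∎
  where open ≤-Reasoning

suc-divMod : ∀ n d .{{_ : NonZero d}} →
  suc n ≡ suc (n / d) * d ⊎ (suc n ≡ suc (n % d) + n / d * d × suc (n % d) < d)
suc-divMod n d with m≤n⇒m<n∨m≡n (m%n<n n d)
... | inj₁ r+1<d = inj₂ (cong suc (m≡m%n+[m/n]*n n d) , r+1<d)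
... | inj₂ r+1≡d = inj₁ (trans (cong suc (m≡m%n+[m/n]*n n d)) (cong (_+ n / d * d) r+1≡d))

/-suc-∣ : ∀ n d .{{_ : NonZero d}} → d ∣ suc n → suc n / d ≡ suc (n / d)
/-suc-∣ n d d∣n+1 with suc-divMod n d
... | inj₁ n≡ = trans (/-congˡ n≡) (m*n/n≡m (suc (n / d)) d)
... | inj₂ (n≡ , r+1<d) = contradiction (trans (sym [n+1]%d≡r+1) (n∣m⇒m%n≡0 (suc n) d d∣n+1)) λ ()
  where
  [n+1]%d≡r+1 : suc n % d ≡ suc (n % d)
  [n+1]%d≡r+1 = trans (%-congˡ n≡) (trans ([m+kn]%n≡m%n (suc (n % d)) (n / d) d) (m<n⇒m%n≡m r+1<d))

/-suc-∤ : ∀ n d .{{_ : NonZero d}} → ¬ d ∣ suc n → suc n / d ≡ n / d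
/-suc-∤ n d d∤n+1 with suc-divMod n d
... | inj₁ n≡ = contradiction (divides (suc (n / d)) n≡) d∤n+1
... | inj₂ (n≡ , r+1<d) = begin
  suc n / d                         ≡⟨ /-congˡ n≡ ⟩
  (suc (n % d) + n / d * d) / d     ≡⟨ +-distrib-/-∣ʳ (suc (n % d)) (divides (n / d) refl) ⟩
  suc (n % d) / d + n / d * d / d   ≡⟨ cong₂ _+_ (m<n⇒m/n≡0 r+1<d) (m*n/n≡m (n / d) d) ⟩
  n / d                             ∎
  where open ≡-Reasoning

sumTo-split-multiples : ∀ d .{{_ : NonZero d}} f n →
  sumTo f n ≡ sumTo (λ x → if ⌊ d ∣? x ⌋ then 0 else f x) n + sumTo (λ y → f (d * y)) (n / d)
sumTo-split-multiples d f zero = cong (sumTo (λ y → f (d * y))) (sym (0/n≡0 d))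
sumTo-split-multiples d f (suc n) with d ∣? suc n
... | yes d∣n+1 = begin
  f (suc n) + sumTo f n                     ≡⟨ cong (f (suc n) +_) (sumTo-split-multiples d f n) ⟩
  f (suc n) + (Σfree + Σmult (n / d))        ≡⟨ x∙yz≈y∙xz (f (suc n)) Σfree (Σmult (n / d)) ⟩
  Σfree + (f (suc n) + Σmult (n / d))        ≡⟨ cong (λ x → Σfree + (f x + Σmult (n / d))) (sym d*[n+1/d]≡n+1) ⟩
  Σfree + Σmult (suc (n / d))                ≡⟨ cong (λ k → Σfree + Σmult k) (sym (/-suc-∣ n d d∣n+1)) ⟩
  Σfree + Σmult (suc n / d)                 ∎
  where
  open ≡-Reasoning
  Σfree = sumTo (λ x → if ⌊ d ∣? x ⌋ then 0 else f x) n
  Σmult = sumTo (λ y → f (d * y))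
  d*[n+1/d]≡n+1 : d * suc (n / d) ≡ suc n
  d*[n+1/d]≡n+1 = trans (cong (d *_) (sym (/-suc-∣ n d d∣n+1))) (m*[n/m]≡n d∣n+1)
... | no d∤n+1 = begin
  f (suc n) + sumTo f n                                 ≡⟨ cong (f (suc n) +_) (sumTo-split-multiples d f n) ⟩
  f (suc n) + (Σfree + Σmult (n / d))                    ≡⟨ +-assoc (f (suc n)) Σfree (Σmult (n / d)) ⟨
  f (suc n) + Σfree + Σmult (n / d)
    ≡⟨ cong (λ k → f (suc n) + Σfree + Σmult k) (sym (/-suc-∤ n d d∤n+1)) ⟩
  f (suc n) + Σfree + Σmult (suc n / d)                 ∎
  where
  open ≡-Reasoning
  Σfree = sumTo (λ x → if ⌊ d ∣? x ⌋ then 0 else f x) n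
  Σmult = sumTo (λ y → f (d * y))

sieved : List ℕ → ℕ → Bool
sieved []       x = true
sieved (q ∷ qs) x = not ⌊ q ∣? x ⌋ ∧ sieved qs x

sieved⇒∤ : ∀ qs x → T (sieved qs x) → All (λ q → ¬ q ∣ x) qs
sieved⇒∤ []       x _ = []
sieved⇒∤ (q ∷ qs) x t with q ∣? x
... | no q∤x = q∤x ∷ sieved⇒∤ qs x t

sieved-*ˡ : ∀ {q} qs y → All (λ r → Coprime r q) qs → sieved qs (q * y) ≡ sieved qs y
sieved-*ˡ         []       y []            = refl
sieved-*ˡ {q} (r ∷ qs) y (r⊥q ∷ qs⊥q) with r ∣? q * y | r ∣? y
... | yes _    | yes _   = refl
... | no  _    | no  _   = sieved-*ˡ qs y qs⊥q
... | yes r∣qy | no  r∤y = contradiction (coprime-divisor r⊥q r∣qy) r∤y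
... | no  r∤qy | yes r∣y = contradiction (∣-trans r∣y (n∣m*n q)) r∤qy

-- In the pass for p, window N c qs x is x when the pair (x , p x) is certainly selected.
window : ℕ → ℕ → List ℕ → ℕ → ℕ
window m c qs x = if sieved qs x ∧ (m <ᵇ c * x) then x else 0

windowSum : ℕ → ℕ → List ℕ → ℕ → ℕ
windowSum m c qs = sumTo (window m c qs)

window-∷ : ∀ m c q qs x → window m c (q ∷ qs) x ≡ (if ⌊ q ∣? x ⌋ then 0 else window m c qs x)
window-∷ m c q qs x with ⌊ q ∣? x ⌋
... | true  = refl
... | false = refl

window-*ˡ : ∀ m c q qs y → All (λ r → Coprime r q) qs →
  window m c qs (q * y) ≡ q * window m (c * q) qs y
window-*ˡ m c q qs y qs⊥q rewrite sieved-*ˡ qs y qs⊥q | sym (*-assoc c q y)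
  with sieved qs y ∧ (m <ᵇ c * q * y)
... | true  = refl
... | false = sym (*-zeroʳ q)

window-[]-≤ : ∀ m c x .{{_ : NonZero c}} → x ≤ m / c → window m c [] x ≡ 0
window-[]-≤ m c x x≤m/c with m <ᵇ c * x | <ᵇ-reflects-< m (c * x)
... | true  | ofʸ m<cx = contradiction (≤-/⇒*-≤ c x≤m/c) (<⇒≱ m<cx)
... | false | ofⁿ _    = refl

window-[]-> : ∀ m c x .{{_ : NonZero c}} → m / c < x → window m c [] x ≡ x
window-[]-> m c x m/c<x with m <ᵇ c * x | <ᵇ-reflects-< m (c * x)
... | true  | ofʸ _    = refl
... | false | ofⁿ m≮cx = contradiction (*-≤⇒≤-/ c (≮⇒≥ m≮cx)) (<⇒≱ m/c<x)

windowSum-[]-≤ : ∀ m c n .{{_ : NonZero c}} → n ≤ m / c → windowSum m c [] n ≡ 0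
windowSum-[]-≤ m c zero    _       = refl
windowSum-[]-≤ m c (suc n) n<m/c =
  cong₂ _+_ (window-[]-≤ m c (suc n) n<m/c) (windowSum-[]-≤ m c n (<⇒≤ n<m/c))

windowSum-[] : ∀ m c n .{{_ : NonZero c}} → m / c ≤ n → windowSum m c [] n + tri (m / c) ≡ tri n
windowSum-[] m c zero    m/c≤0 rewrite n≤0⇒n≡0 m/c≤0 = refl
windowSum-[] m c (suc n) m/c≤n+1 with m / c ≤? n
... | yes m/c≤n = begin
  window m c [] (suc n) + windowSum m c [] n + tri (m / c)
    ≡⟨ cong (λ w → w + windowSum m c [] n + tri (m / c)) (window-[]-> m c (suc n) (s≤s m/c≤n)) ⟩
  suc n + windowSum m c [] n + tri (m / c)  ≡⟨ +-assoc (suc n) _ _ ⟩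
  suc n + (windowSum m c [] n + tri (m / c)) ≡⟨ cong (suc n +_) (windowSum-[] m c n m/c≤n) ⟩
  suc n + tri n                              ∎
  where open ≡-Reasoning
... | no m/c≰n with ≤-antisym m/c≤n+1 (≰⇒> m/c≰n)
...   | m/c≡n+1 rewrite m/c≡n+1 =
  cong (_+ tri (suc n)) (windowSum-[]-≤ m c (suc n) (≤-reflexive (sym m/c≡n+1)))

windowSum-sieve : ∀ m c q qs n k .{{_ : NonZero q}} .{{_ : NonZero k}} .{{_ : NonZero (k * q)}} →
  All (λ r → Coprime r q) qs →
  windowSum m c (q ∷ qs) (n / k) + q * windowSum m (c * q) qs (n / (k * q)) ≡ windowSum m c qs (n / k)
windowSum-sieve m c q qs n k qs⊥q = sym (begin
  windowSum m c qs (n / k)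
    ≡⟨ sumTo-split-multiples q (window m c qs) (n / k) ⟩
  sumTo (λ x → if ⌊ q ∣? x ⌋ then 0 else window m c qs x) (n / k)
    + sumTo (λ y → window m c qs (q * y)) (n / k / q)
    ≡⟨ cong₂ _+_ (sumTo-cong (λ x → sym (window-∷ m c q qs x)) (n / k))
                 (sumTo-cong (λ y → window-*ˡ m c q qs y qs⊥q) (n / k / q)) ⟩
  windowSum m c (q ∷ qs) (n / k) + sumTo (λ y → q * window m (c * q) qs y) (n / k / q)
    ≡⟨ cong (windowSum m c (q ∷ qs) (n / k) +_) (sumTo-*ˡ q (window m (c * q) qs) (n / k / q)) ⟩
  windowSum m c (q ∷ qs) (n / k) + q * windowSum m (c * q) qs (n / k / q)
    ≡⟨ cong (λ j → windowSum m c (q ∷ qs) (n / k) + q * windowSum m (c * q) qs j) (m/n/o≡m/[n*o] n k q) ⟩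
  windowSum m c (q ∷ qs) (n / k) + q * windowSum m (c * q) qs (n / (k * q)) ∎)
  where open ≡-Reasoning

Avoids : ℕ → Pair → Set
Avoids v (a , b) = v ≢ a × v ≢ b

occurs-avoided : ∀ {v} sel → All (Avoids v) sel → occurs v sel ≡ false
occurs-avoided {v} []             []                 = refl
occurs-avoided {v} ((a , b) ∷ sel) ((v≢a , v≢b) ∷ av) with v ≟ a | v ≟ b
... | yes v≡a | _       = contradiction v≡a v≢a
... | no _    | yes v≡b = contradiction v≡b v≢b
... | no _    | no _    = occurs-avoided sel av

step-new : ∀ {a b} sel → All (Avoids a) sel → All (Avoids b) sel → step sel (a , b) ≡ (a , b) ∷ sel
step-new sel av-a av-b rewrite occurs-avoided sel av-a | occurs-avoided sel av-b = refl

step-cases : ∀ sel pair → step sel pair ≡ sel ⊎ step sel pair ≡ pair ∷ sel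
step-cases sel (a , b) with occurs a sel ∨ occurs b sel
... | true  = inj₁ refl
... | false = inj₂ refl

step-All : ∀ {P : Pair → Set} {pair} sel → P pair → All P sel → All P (step sel pair)
step-All {pair = pair} sel p ps with step-cases sel pair
... | inj₁ ≡sel  rewrite ≡sel  = ps
... | inj₂ ≡cons rewrite ≡cons = p ∷ ps

step-score : ∀ sel pair → score sel ≤ score (step sel pair)
step-score sel (a , b) with step-cases sel (a , b)
... | inj₁ ≡sel  rewrite ≡sel  = ≤-refl
... | inj₂ ≡cons rewrite ≡cons = m≤n+m (score sel) b

-- The invariant of the pairs already chosen when the pass for the prime p reaches x,
-- the passes for the primes qs being finished.
Chosen : (N p : ℕ) → List ℕ → ℕ → Pair → Set
Chosen N p qs x (a , b) = b ≤ N × (b ≡ p * a × x < a ⊎ ∃[ q ] q ∈ qs × b ≡ q * a)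

Chosen-next : ∀ {N p p′ qs x pair} → Chosen N p qs 0 pair → Chosen N p′ (p ∷ qs) x pair
Chosen-next {pair = _ , _} (b≤N , inj₁ (b≡pa , _))             = b≤N , inj₂ (_ , here refl , b≡pa)
Chosen-next {pair = _ , _} (b≤N , inj₂ (q , q∈qs , b≡qa))      = b≤N , inj₂ (q , there q∈qs , b≡qa)

module Pass (N p c : ℕ) .{{_ : NonZero p}} (qs : List ℕ)
            (c≤p*p : c ≤ p * p) (qs-valid : All (λ q → c ≤ q × Coprime q p) qs) where

  admissible : ℕ → Bool
  admissible x = sieved qs x ∧ (N <ᵇ c * x)

  pass : ℕ → List Pair → List Pair
  pass n sel = foldl step sel (map (λ x → (x , p * x)) (downTo1 n))

  private
    overflow : ∀ {x b} → N < c * x → c * x ≤ b → b ≤ N → ⊥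
    overflow N<cx cx≤b b≤N = <⇒≱ N<cx (≤-trans cx≤b b≤N)

  current-avoids : ∀ {x a b} → N < c * x → b ≤ N → b ≡ p * a → x < a →
    Avoids x (a , b) × Avoids (p * x) (a , b)
  current-avoids {x} {a} {b} N<cx b≤N b≡pa x<a =
    (<⇒≢ x<a , λ x≡b → <⇒≢ (<-≤-trans x<a (m≤n*m a p)) (trans x≡b b≡pa)) ,
    (λ px≡a → overflow N<cx (cx≤b px≡a) b≤N) ,
    (λ px≡b → <⇒≢ x<a (*-cancelˡ-≡ x a p (trans px≡b b≡pa)))
    where
    open ≤-Reasoning
    cx≤b : p * x ≡ a → c * x ≤ b
    cx≤b px≡a = begin
      c * x       ≤⟨ *-monoˡ-≤ x c≤p*p ⟩
      p * p * x   ≡⟨ *-assoc p p x ⟩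
      p * (p * x) ≡⟨ cong (p *_) px≡a ⟩
      p * a       ≡⟨ b≡pa ⟨
      b           ∎

  earlier-avoids : ∀ {x a b q} → N < c * x → b ≤ N → c ≤ q → Coprime q p → ¬ q ∣ x → b ≡ q * a →
    Avoids x (a , b) × Avoids (p * x) (a , b)
  earlier-avoids {x} {a} {b} {q} N<cx b≤N c≤q q⊥p q∤x b≡qa =
    ((λ x≡a → overflow N<cx (cx≤b (≤-reflexive (cong (q *_) x≡a))) b≤N) ,
     (λ x≡b → q∤x (divides a (trans (trans x≡b b≡qa) (*-comm q a))))) ,
    ((λ px≡a → overflow N<cx (cx≤b (≤-trans (*-monoʳ-≤ q (m≤n*m x p)) (≤-reflexive (cong (q *_) px≡a)))) b≤N) ,
     (λ px≡b → q∤x (coprime-divisor q⊥p (divides a (trans (trans px≡b b≡qa) (*-comm q a))))))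
    where
    cx≤b : q * x ≤ q * a → c * x ≤ b
    cx≤b qx≤qa = ≤-trans (*-monoˡ-≤ x c≤q) (≤-trans qx≤qa (≤-reflexive (sym b≡qa)))

  admissible-avoids : ∀ {x pair} → T (admissible x) → Chosen N p qs x pair →
    Avoids x pair × Avoids (p * x) pair
  admissible-avoids {x} {a , b} adm (b≤N , chosen) with Equivalence.to (T-∧ {sieved qs x}) adm
  ... | sv , N<ᵇcx with chosen
  ...   | inj₁ (b≡pa , x<a) = current-avoids (<ᵇ⇒< N (c * x) N<ᵇcx) b≤N b≡pa x<a
  ...   | inj₂ (q , q∈qs , b≡qa) =
    earlier-avoids (<ᵇ⇒< N (c * x) N<ᵇcx) b≤N (proj₁ valid) (proj₂ valid)
                   (All.lookup (sieved⇒∤ qs x sv) q∈qs) b≡qa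
    where valid = All.lookup qs-valid q∈qs

  Chosen-suc⁻ : ∀ {x pair} → Chosen N p qs (suc x) pair → Chosen N p qs x pair
  Chosen-suc⁻ {pair = _ , _} (b≤N , inj₁ (b≡pa , x<a)) = b≤N , inj₁ (b≡pa , <⇒≤ x<a)
  Chosen-suc⁻ {pair = _ , _} (b≤N , inj₂ earlier)      = b≤N , inj₂ earlier

  new-Chosen : ∀ {n} → suc n ≤ N / p → Chosen N p qs n (suc n , p * suc n)
  new-Chosen n<N/p = ≤-/⇒*-≤ p n<N/p , inj₁ (refl , ≤-refl)

  pass-Chosen : ∀ n sel → n ≤ N / p → All (Chosen N p qs n) sel → All (Chosen N p qs 0) (pass n sel)
  pass-Chosen zero    sel _     inv = inv
  pass-Chosen (suc n) sel n<N/p inv =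
    pass-Chosen n _ (<⇒≤ n<N/p) (step-All sel (new-Chosen n<N/p) (All.map Chosen-suc⁻ inv))

  pass-score : ∀ n sel → n ≤ N / p → All (Chosen N p qs n) sel →
    score sel + p * windowSum N c qs n ≤ score (pass n sel)
  pass-score zero sel _ _ = ≤-reflexive (trans (cong (score sel +_) (*-zeroʳ p)) (+-identityʳ _))
  pass-score (suc n) sel n<N/p inv with admissible (suc n) in adm
  ... | true = begin
    score sel + p * (suc n + windowSum N c qs n)       ≡⟨ regroup (score sel) p (suc n) _ ⟩
    score ((suc n , p * suc n) ∷ sel) + p * windowSum N c qs n
                                                      ≤⟨ pass-score n _ (<⇒≤ n<N/p) inv′ ⟩
    score (pass n ((suc n , p * suc n) ∷ sel))         ≡⟨ cong (score ∘ pass n) selected ⟨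
    score (pass n (step sel (suc n , p * suc n)))      ∎
    where
    open ≤-Reasoning
    regroup : ∀ s p x w → s + p * (x + w) ≡ p * x + s + p * w
    regroup = solve-∀
    avoid : All (λ pair → Avoids (suc n) pair × Avoids (p * suc n) pair) sel
    avoid = All.map (admissible-avoids (Equivalence.from T-≡ adm)) inv
    selected : step sel (suc n , p * suc n) ≡ (suc n , p * suc n) ∷ sel
    selected = step-new sel (All.map proj₁ avoid) (All.map proj₂ avoid)
    inv′ : All (Chosen N p qs n) ((suc n , p * suc n) ∷ sel)
    inv′ = new-Chosen n<N/p ∷ All.map Chosen-suc⁻ inv
  ... | false = begin
    score sel + p * windowSum N c qs n                 ≤⟨ +-monoˡ-≤ _ (step-score sel _) ⟩
    score (step sel (suc n , p * suc n)) + p * windowSum N c qs n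
                                                      ≤⟨ pass-score n _ (<⇒≤ n<N/p) inv′ ⟩
    score (pass n (step sel (suc n , p * suc n)))      ∎
    where
    open ≤-Reasoning
    inv′ : All (Chosen N p qs n) (step sel (suc n , p * suc n))
    inv′ = step-All sel (new-Chosen n<N/p) (All.map Chosen-suc⁻ inv)

guaranteedScore : ℕ → ℕ
guaranteedScore N =
  5 * windowSum N 25 [] (N / 5) + 3 * windowSum N 5 (5 ∷ []) (N / 3) + 2 * windowSum N 3 (3 ∷ 5 ∷ []) (N / 2)

bornFree5-score : ∀ N → guaranteedScore N ≤ score (bornFree5 N)
bornFree5-score N = begin
  guaranteedScore N                           ≤⟨ +-monoˡ-≤ A₂ (+-monoˡ-≤ A₃ (P₅.pass-score (N / 5) [] ≤-refl [])) ⟩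
  score sel₅ + A₃ + A₂                        ≤⟨ +-monoˡ-≤ A₂ (P₃.pass-score (N / 3) sel₅ ≤-refl inv₅) ⟩
  score sel₃ + A₂                             ≤⟨ P₂.pass-score (N / 2) sel₃ ≤-refl inv₃ ⟩
  score (P₂.pass (N / 2) sel₃)                ≡⟨ cong score (foldl-++ step sel₅ (S 3 N) (S 2 N)) ⟨
  score (foldl step sel₅ (S 3 N ++ S 2 N))   ≡⟨ cong score (foldl-++ step [] (S 5 N) (S 3 N ++ S 2 N)) ⟨
  score (bornFree5 N)                         ∎
  where
  open ≤-Reasoning
  module P₅ = Pass N 5 25 [] ≤-refl []
  module P₃ = Pass N 3 5 (5 ∷ []) (≤ᵇ⇒≤ 5 9 _) ((≤-refl , toWitness {a? = coprime? 5 3} _) ∷ [])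
  module P₂ = Pass N 2 3 (3 ∷ 5 ∷ []) (≤ᵇ⇒≤ 3 4 _)
    ((≤-refl , toWitness {a? = coprime? 3 2} _) ∷ (≤ᵇ⇒≤ 3 5 _ , toWitness {a? = coprime? 5 2} _) ∷ [])
  A₃ = 3 * windowSum N 5 (5 ∷ []) (N / 3)
  A₂ = 2 * windowSum N 3 (3 ∷ 5 ∷ []) (N / 2)
  sel₅ = P₅.pass (N / 5) []
  sel₃ = P₃.pass (N / 3) sel₅
  inv₅ : All (Chosen N 3 (5 ∷ []) (N / 3)) sel₅
  inv₅ = All.map (Chosen-next {N} {5} {3} {[]}) (P₅.pass-Chosen (N / 5) [] ≤-refl [])
  inv₃ : All (Chosen N 2 (3 ∷ 5 ∷ []) (N / 2)) sel₃
  inv₃ = All.map (Chosen-next {N} {3} {2} {5 ∷ []}) (P₃.pass-Chosen (N / 3) sel₅ ≤-refl inv₅)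

-- Division with the junk value n ÷ 0 = 0, so that a term may carry any divisor.
_÷_ : ℕ → ℕ → ℕ
n ÷ zero    = 0
n ÷ (suc k) = n / suc k

÷-+ : ∀ k {d} n → k ∣ d → (n + d) ÷ k ≡ n ÷ k + d ÷ k
÷-+ zero    n _   = refl
÷-+ (suc k) n k∣d = +-distrib-/-∣ʳ n k∣d

triComb : List (ℕ × ℕ) → ℕ → ℕ
triComb []             N = 0
triComb ((c , k) ∷ ts) N = c * tri (N ÷ k) + triComb ts N

slope : List (ℕ × ℕ) → ℕ → ℕ → ℕ
slope []             d N = 0
slope ((c , k) ∷ ts) d N = c * (N ÷ k * (d ÷ k) + tri (d ÷ k)) + slope ts d N

curvature : List (ℕ × ℕ) → ℕ → ℕ
curvature []             d = 0
curvature ((c , k) ∷ ts) d = c * (d ÷ k * (d ÷ k)) + curvature ts d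

DividesAll : ℕ → List (ℕ × ℕ) → Set
DividesAll d = All (λ t → proj₂ t ∣ d)

triComb-shift : ∀ ts d N → DividesAll d ts → triComb ts (N + d) ≡ triComb ts N + slope ts d N
triComb-shift []             d N []           = refl
triComb-shift ((c , k) ∷ ts) d N (k∣d ∷ ts∣d) = begin
  c * tri ((N + d) ÷ k) + triComb ts (N + d)
    ≡⟨ cong₂ (λ j r → c * tri j + r) (÷-+ k N k∣d) (triComb-shift ts d N ts∣d) ⟩
  c * tri (N ÷ k + d ÷ k) + (triComb ts N + slope ts d N)
    ≡⟨ cong (λ t → c * t + (triComb ts N + slope ts d N)) (tri-+ (N ÷ k) (d ÷ k)) ⟩
  c * (tri (N ÷ k) + (N ÷ k * (d ÷ k) + tri (d ÷ k))) + (triComb ts N + slope ts d N)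
    ≡⟨ cong (_+ (triComb ts N + slope ts d N)) (*-distribˡ-+ c _ _) ⟩
  c * tri (N ÷ k) + c * (N ÷ k * (d ÷ k) + tri (d ÷ k)) + (triComb ts N + slope ts d N)
    ≡⟨ interchange (c * tri (N ÷ k)) _ (triComb ts N) (slope ts d N) ⟩
  c * tri (N ÷ k) + triComb ts N + (c * (N ÷ k * (d ÷ k) + tri (d ÷ k)) + slope ts d N) ∎
  where open ≡-Reasoning

slope-shift : ∀ ts d N → DividesAll d ts → slope ts d (N + d) ≡ slope ts d N + curvature ts d
slope-shift []             d N []           = refl
slope-shift ((c , k) ∷ ts) d N (k∣d ∷ ts∣d) = begin
  c * ((N + d) ÷ k * (d ÷ k) + tri (d ÷ k)) + slope ts d (N + d)
    ≡⟨ cong₂ (λ j r → c * (j * (d ÷ k) + tri (d ÷ k)) + r) (÷-+ k N k∣d) (slope-shift ts d N ts∣d) ⟩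
  c * ((N ÷ k + d ÷ k) * (d ÷ k) + tri (d ÷ k)) + (slope ts d N + curvature ts d)
    ≡⟨ regroup c (N ÷ k) (d ÷ k) (tri (d ÷ k)) (slope ts d N) (curvature ts d) ⟩
  c * (N ÷ k * (d ÷ k) + tri (d ÷ k)) + slope ts d N + (c * (d ÷ k * (d ÷ k)) + curvature ts d) ∎
  where
  open ≡-Reasoning
  regroup : ∀ c a b t u v → c * ((a + b) * b + t) + (u + v) ≡ c * (a * b + t) + u + (c * (b * b) + v)
  regroup = solve-∀

periodic-induction : ∀ {P : ℕ → Set} a d .{{_ : NonZero d}} →
  (∀ {r} → r < d → P (a + r)) → (∀ n → P n → P (n + d)) → ∀ n → a ≤ n → P n
periodic-induction {P} a d base step n a≤n = subst P a+r+qd≡n (iterate ((n ∸ a) / d) (base (m%n<n (n ∸ a) d)))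
  where
  iterate : ∀ q {m} → P m → P (m + q * d)
  iterate zero    {m} Pm = subst P (sym (+-identityʳ m)) Pm
  iterate (suc q) {m} Pm = subst P (trans (+-assoc m (q * d) d) (cong (m +_) (+-comm (q * d) d))) (step _ (iterate q Pm))
  a+r+qd≡n : a + (n ∸ a) % d + (n ∸ a) / d * d ≡ n
  a+r+qd≡n = trans (+-assoc a _ _) (trans (cong (a +_) (sym (m≡m%n+[m/n]*n (n ∸ a) d))) (m+[n∸m]≡n a≤n))

triComb-<-periodic : ∀ L R a d .{{_ : NonZero d}} → DividesAll d L → DividesAll d R →
  curvature L d ≤ curvature R d →
  (∀ {r} → r < d → slope L d r ≤ slope R d r) →
  (∀ {r} → r < d → triComb L (a + r) < triComb R (a + r)) →
  ∀ N → a ≤ N → triComb L N < triComb R N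
triComb-<-periodic L R a d L∣d R∣d curv≤ slope≤-base <-base =
  periodic-induction a d <-base λ n L<R →
    subst₂ _<_ (sym (triComb-shift L d n L∣d)) (sym (triComb-shift R d n R∣d)) (+-mono-<-≤ L<R (slope≤ n))
  where
  slope≤ : ∀ n → slope L d n ≤ slope R d n
  slope≤ n = periodic-induction 0 d slope≤-base (λ m L≤R →
    subst₂ _≤_ (sym (slope-shift L d m L∣d)) (sym (slope-shift R d m R∣d)) (+-mono-≤ L≤R curv≤)) n z≤n

/-anti : ∀ N a b .{{_ : NonZero a}} .{{_ : NonZero b}} → {T (a ≤ᵇ b)} → N / b ≤ N / a
/-anti N a b {a≤b} = /-monoʳ-≤ N (≤ᵇ⇒≤ a b a≤b)

sieve-3 : ∀ N →
  windowSum N 5 (5 ∷ []) (N / 3) + tri (N / 5) + 5 * tri (N / 15) ≡ tri (N / 3) + 5 * tri (N / 25)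
sieve-3 N = linear (windowSum N 5 (5 ∷ []) (N / 3)) (windowSum N 25 [] (N / 15)) (tri (N / 5)) (tri (N / 25))
  (windowSum-sieve N 5 5 [] N 3 [])
  (windowSum-[] N 5 (N / 3) (/-anti N 3 5))
  (windowSum-[] N 25 (N / 15) (/-anti N 15 25))
  where
  linear : ∀ a w t₅ t₂₅ {s t₃ t₁₅} → a + 5 * w ≡ s → s + t₅ ≡ t₃ → w + t₂₅ ≡ t₁₅ →
    a + t₅ + 5 * t₁₅ ≡ t₃ + 5 * t₂₅
  linear a w t₅ t₂₅ refl refl refl = solve (List ℕ ∋ (a ∷ w ∷ t₅ ∷ t₂₅ ∷ []))

sieve-2 : ∀ N →
  windowSum N 3 (3 ∷ 5 ∷ []) (N / 2) + tri (N / 3) + 5 * tri (N / 10) + 3 * tri (N / 6) + 15 * tri (N / 45)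
    ≡ tri (N / 2) + 5 * tri (N / 15) + 3 * tri (N / 9) + 15 * tri (N / 30)
sieve-2 N =
  linear (windowSum N 3 (3 ∷ 5 ∷ []) (N / 2)) (windowSum N 9 (5 ∷ []) (N / 6))
         (windowSum N 15 [] (N / 10)) (windowSum N 45 [] (N / 30))
         (tri (N / 3)) (tri (N / 15)) (tri (N / 9)) (tri (N / 45))
    (windowSum-sieve N 3 3 (5 ∷ []) N 2 (toWitness {a? = coprime? 5 3} _ ∷ []))
    (windowSum-sieve N 3 5 [] N 2 [])
    (windowSum-sieve N 9 5 [] N 6 [])
    (windowSum-[] N 3 (N / 2) (/-anti N 2 3))
    (windowSum-[] N 15 (N / 10) (/-anti N 10 15))
    (windowSum-[] N 9 (N / 6) (/-anti N 6 9))
    (windowSum-[] N 45 (N / 30) (/-anti N 30 45))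
  where
  linear : ∀ a b g z t₃ t₁₅ t₉ t₄₅ {h g₀ b₀ t₂ t₁₀ t₆ t₃₀} →
    a + 3 * b ≡ h → h + 5 * g ≡ g₀ → b + 5 * z ≡ b₀ →
    g₀ + t₃ ≡ t₂ → g + t₁₅ ≡ t₁₀ → b₀ + t₉ ≡ t₆ → z + t₄₅ ≡ t₃₀ →
    a + t₃ + 5 * t₁₀ + 3 * t₆ + 15 * t₄₅ ≡ t₂ + 5 * t₁₅ + 3 * t₉ + 15 * t₃₀
  linear a b g z t₃ t₁₅ t₉ t₄₅ refl refl refl refl refl refl refl =
    solve (List ℕ ∋ (a ∷ b ∷ g ∷ z ∷ t₃ ∷ t₁₅ ∷ t₉ ∷ t₄₅ ∷ []))

L′ L R : List (ℕ × ℕ)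
L′ = (10 , 25) ∷ (6 , 5) ∷ (30 , 15) ∷ (4 , 3) ∷ (12 , 6) ∷ (20 , 10) ∷ (60 , 45) ∷ []
L  = (1 , 1) ∷ L′
R  = (10 , 5) ∷ (30 , 25) ∷ (6 , 3) ∷ (4 , 2) ∷ (12 , 9) ∷ (20 , 15) ∷ (60 , 30) ∷ []

guaranteedScore-identity : ∀ N → 2 * guaranteedScore N + triComb L′ N ≡ triComb R N
guaranteedScore-identity N =
  linear (windowSum N 25 [] (N / 5)) (windowSum N 5 (5 ∷ []) (N / 3)) (windowSum N 3 (3 ∷ 5 ∷ []) (N / 2))
         (tri (N / 2)) (tri (N / 3)) (tri (N / 5)) (tri (N / 6)) (tri (N / 9)) (tri (N / 10))
         (tri (N / 15)) (tri (N / 25)) (tri (N / 30)) (tri (N / 45))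
    (windowSum-[] N 25 (N / 5) (/-anti N 5 25)) (sieve-3 N) (sieve-2 N)
  where
  linear : ∀ a₅ a₃ a₂ t₂ t₃ t₅ t₆ t₉ t₁₀ t₁₅ t₂₅ t₃₀ t₄₅ →
    a₅ + t₂₅ ≡ t₅ →
    a₃ + t₅ + 5 * t₁₅ ≡ t₃ + 5 * t₂₅ →
    a₂ + t₃ + 5 * t₁₀ + 3 * t₆ + 15 * t₄₅ ≡ t₂ + 5 * t₁₅ + 3 * t₉ + 15 * t₃₀ →
    2 * (5 * a₅ + 3 * a₃ + 2 * a₂)
      + (10 * t₂₅ + (6 * t₅ + (30 * t₁₅ + (4 * t₃ + (12 * t₆ + (20 * t₁₀ + (60 * t₄₅ + 0)))))))
    ≡ 10 * t₅ + (30 * t₂₅ + (6 * t₃ + (4 * t₂ + (12 * t₉ + (20 * t₁₅ + (60 * t₃₀ + 0))))))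
  linear a₅ a₃ a₂ t₂ t₃ t₅ t₆ t₉ t₁₀ t₁₅ t₂₅ t₃₀ t₄₅ e₅ e₃ e₂ = begin
    2 * (5 * a₅ + 3 * a₃ + 2 * a₂)
      + (10 * t₂₅ + (6 * t₅ + (30 * t₁₅ + (4 * t₃ + (12 * t₆ + (20 * t₁₀ + (60 * t₄₅ + 0)))))))
      ≡⟨ solve (List ℕ ∋ (a₅ ∷ a₃ ∷ a₂ ∷ t₃ ∷ t₅ ∷ t₆ ∷ t₁₀ ∷ t₁₅ ∷ t₂₅ ∷ t₄₅ ∷ [])) ⟩
    10 * (a₅ + t₂₅) + 6 * (a₃ + t₅ + 5 * t₁₅) + 4 * (a₂ + t₃ + 5 * t₁₀ + 3 * t₆ + 15 * t₄₅)
      ≡⟨ cong₂ _+_ (cong₂ _+_ (cong (10 *_) e₅) (cong (6 *_) e₃)) (cong (4 *_) e₂) ⟩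
    10 * t₅ + 6 * (t₃ + 5 * t₂₅) + 4 * (t₂ + 5 * t₁₅ + 3 * t₉ + 15 * t₃₀)
      ≡⟨ solve (List ℕ ∋ (t₂ ∷ t₃ ∷ t₅ ∷ t₉ ∷ t₁₅ ∷ t₂₅ ∷ t₃₀ ∷ [])) ⟩
    10 * t₅ + (30 * t₂₅ + (6 * t₃ + (4 * t₂ + (12 * t₉ + (20 * t₁₅ + (60 * t₃₀ + 0)))))) ∎
    where open ≡-Reasoning

triComb-L<R : ∀ N → 847 ≤ N → triComb L N < triComb R N
triComb-L<R = triComb-<-periodic L R 847 450
  (toWitness {a? = All.all? (λ t → proj₂ t ∣? 450) L} _)
  (toWitness {a? = All.all? (λ t → proj₂ t ∣? 450) R} _)
  (≤ᵇ⇒≤ (curvature L 450) (curvature R 450) _)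
  (toWitness {a? = allUpTo? (λ r → slope L 450 r ≤? slope R 450 r) 450} _)
  (toWitness {a? = allUpTo? (λ r → triComb L (847 + r) <? triComb R (847 + r)) 450} _)

theorem4 : (N : ℕ) → 847 ≤ N → pot N < 2 * score (bornFree5 N)
theorem4 N 847≤N = begin-strict
  pot N                    ≡⟨ pot≡tri N ⟩
  tri N                    ≡⟨ cong tri (n/1≡n N) ⟨
  tri (N / 1)              ≡⟨ *-identityˡ (tri (N / 1)) ⟨
  1 * tri (N / 1)          <⟨ +-cancelʳ-< (triComb L′ N) _ _ L<2G ⟩
  2 * guaranteedScore N    ≤⟨ *-monoʳ-≤ 2 (bornFree5-score N) ⟩
  2 * score (bornFree5 N)  ∎
  where
  open ≤-Reasoning
  L<2G : triComb L N < 2 * guaranteedScore N + triComb L′ N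
  L<2G = subst (triComb L N <_) (sym (guaranteedScore-identity N)) (triComb-L<R N 847≤N)
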